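{- Let $r\ge1$. For $j\ge 1$, $k\ge 1$ and $n\ge 0$, the number of overpartitions $\pi$ of $n$ such that $maes(\pi;r)=k$ and exactly $j$ parts of $\pi$ have size greater than $k$ equals the number of overpartitions $\lambda$ of $n$ such that the smallest positive $(r+1)$-repeating size of $\lambda$ is $j$ and exactly $k+1$ parts of $\lambda$ have size greater than or equal to $j$.
   Context: An overpartition of $n$ is a partition of $n$ in which the last occurrence of each distinct part value may be overlined. A part equal to $t$ or $\overline t$ has size $t$. For an overpartition $\pi$, $maes(\pi;r)$ is the largest positive integer $t$ less than the size of the largest part of $\pi$ such that $t\ge r$ and $\pi$ has no parts of size $t,t-1,\ldots,t-r+1$; if no such $t$ exists, $maes(\pi;r)=0$. A positive integer $j$ is an $(r+1)$-repeating size of $\lambda$ if $\lambda$ has at least $r+1$ parts of size $j$. -}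

module Defs where

open import Data.Nat.Base using (ℕ; zero; suc; _+_; _∸_; _⊔_; _≡ᵇ_; _<ᵇ_; _≤ᵇ_)
open import Data.Bool.Base using (Bool; true; false; _∧_; not; if_then_else_; T)
open import Data.Product.Base using (_×_; _,_; proj₁; proj₂; Σ)
open import Data.List.Base using (List; []; _∷_; upTo)
open import Relation.Binary.PropositionalEquality using (_≡_)

-- A part is a pair (size , overlined?).  An overpartition is a list of parts
-- written in non-increasing order of size, in which among equal sizes only the
-- LAST occurrence may be overlined.  This canonical form makes the list
-- representation of an overpartition unique.
Part : Set
Part = ℕ × Bool

size : Part → ℕ
size = proj₁

adjOK : Part → Part → Bool
adjOK (a , oa) (b , ob) = (b ≤ᵇ a) ∧ (if a ≡ᵇ b then not oa else true)

wellOrdered : List Part → Bool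
wellOrdered []             = true
wellOrdered (p ∷ [])       = true
wellOrdered (p ∷ q ∷ rest) = adjOK p q ∧ wellOrdered (q ∷ rest)

allPositive : List Part → Bool
allPositive []       = true
allPositive (p ∷ ps) = (1 ≤ᵇ size p) ∧ allPositive ps

total : List Part → ℕ
total []       = 0
total (p ∷ ps) = size p + total ps

isOverpartitionOf : ℕ → List Part → Bool
isOverpartitionOf n π = wellOrdered π ∧ allPositive π ∧ (total π ≡ᵇ n)

Overpartition : ℕ → Set
Overpartition n = Σ (List Part) (λ π → T (isOverpartitionOf n π))

largest : List Part → ℕ
largest []       = 0
largest (p ∷ ps) = size p ⊔ largest ps

mult : List Part → ℕ → ℕ
mult []       s = 0
mult (p ∷ ps) s = (if size p ≡ᵇ s then 1 else 0) + mult ps s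

hasSize : List Part → ℕ → Bool
hasSize π s = 1 ≤ᵇ mult π s

allL : (ℕ → Bool) → List ℕ → Bool
allL f []       = true
allL f (x ∷ xs) = f x ∧ allL f xs

gapAt : List Part → ℕ → ℕ → Bool
gapAt π r t = (r ≤ᵇ t) ∧ allL (λ i → not (hasSize π (t ∸ i))) (upTo r)

searchDown : List Part → ℕ → ℕ → ℕ
searchDown π r zero    = 0
searchDown π r (suc m) = if gapAt π r (suc m) then suc m else searchDown π r m

maes : List Part → ℕ → ℕ
maes π r = searchDown π r (largest π ∸ 1)

countGt : ℕ → List Part → ℕ
countGt k []       = 0
countGt k (p ∷ ps) = (if k <ᵇ size p then 1 else 0) + countGt k ps

countGe : ℕ → List Part → ℕ
countGe j []       = 0
countGe j (p ∷ ps) = (if j ≤ᵇ size p then 1 else 0) + countGe j ps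

repeating : ℕ → List Part → ℕ → Bool
repeating r λ' j = suc r ≤ᵇ mult λ' j

isSmallestRepeating : ℕ → List Part → ℕ → Bool
isSmallestRepeating r λ' j =
  (1 ≤ᵇ j) ∧ repeating r λ' j ∧ allL (λ i → not ((1 ≤ᵇ i) ∧ repeating r λ' i)) (upTo j)

SetA : ℕ → ℕ → ℕ → ℕ → Set
SetA r j k n = Σ (Overpartition n) (λ π → (maes (proj₁ π) r ≡ k) × (countGt k (proj₁ π) ≡ j))

SetB : ℕ → ℕ → ℕ → ℕ → Set
SetB r j k n = Σ (Overpartition n)
  (λ λ' → T (isSmallestRepeating r (proj₁ λ') j) × (countGe j (proj₁ λ') ≡ suc k))

{-# OPTIONS --safe #-}

-- Encode an overpartition by its blocks of equal parts, from the largest size down: each block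
-- records its multiplicity and how many sizes are missing just below it.  Conjugation (transposing
-- the Ferrers diagram, every overline staying on its corner) exchanges these two numbers and
-- reverses the order of the blocks.  maes(π; r) = k means that the first block from the top with at
-- least r missing sizes below it has size s = k + 1, and the j parts larger than k are the parts of
-- size ≥ s.  In the conjugate this block is the last one with more than r equal parts, so it has
-- the smallest (r+1)-repeating size, namely j, and its k + 1 parts of size ≥ j are the first s
-- columns of π.

module Submission where

open import Defs
open import Data.Bool.Base using (Bool; true; false; _∧_; not; if_then_else_; T)
open import Data.Bool.Properties using (T-≡; T-∧; T-irrelevant; ¬-not; ∧-zeroʳ)
open import Data.List.Base using (List; []; _∷_; _++_; [_]; upTo)
open import Data.List.Properties using (++-identityʳ; ++-assoc)
open import Data.List.Membership.Propositional using (_∈_)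
open import Data.List.Membership.Propositional.Properties using (∈-upTo⁺; ∈-upTo⁻)
open import Data.List.Relation.Unary.Any using (here; there)
open import Data.Maybe.Base as Maybe using (Maybe; just; nothing; maybe′)
open import Data.Maybe.Properties using (maybe′-map)
open import Data.Nat.Base
  using (ℕ; zero; suc; _+_; _*_; _∸_; _⊔_; _≡ᵇ_; _<ᵇ_; _≤ᵇ_; _≤_; _<_; _≤′_; ≤′-refl; ≤′-step; z≤n; s≤s)
open import Data.Nat.Properties
open import Data.Nat.Tactic.RingSolver using (solve-∀)
open import Data.Product.Base using (_×_; _,_; proj₁; proj₂; Σ; ∃; map₁; map₂)
open import Data.Product.Properties using (Σ-≡,≡→≡)
open import Function.Base using (_∘_)
open import Function.Bundles using (_↔_; Equivalence; mk↔ₛ′)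
open import Relation.Nullary using (¬_; yes; no; contradiction)
open import Relation.Binary.Definitions using (tri<; tri≈; tri>)
open import Relation.Nullary.Reflects using (Reflects; ofʸ; ofⁿ; fromEquivalence)
open import Relation.Unary using (Irrelevant)
import Relation.Nullary.Irrelevant as Nullary
open import Relation.Binary.PropositionalEquality hiding ([_])

open Equivalence using (to; from)

reflects-⇒ : ∀ {A : Set} {b} → Reflects A b → b ≡ true → A
reflects-⇒ (ofʸ a) _ = a

reflects-⇐ : ∀ {A : Set} {b} → Reflects A b → A → b ≡ true
reflects-⇐ (ofʸ _)  _ = refl
reflects-⇐ (ofⁿ ¬a) a = contradiction a ¬a

reflects-¬⇐ : ∀ {A : Set} {b} → Reflects A b → ¬ A → b ≡ false
reflects-¬⇐ (ofʸ a) ¬a = contradiction a ¬a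
reflects-¬⇐ (ofⁿ _) _  = refl

reflects-¬⇒ : ∀ {A : Set} {b} → Reflects A b → b ≡ false → ¬ A
reflects-¬⇒ (ofⁿ ¬a) _ = ¬a

≡ᵇ-reflects-≡ : ∀ m n → Reflects (m ≡ n) (m ≡ᵇ n)
≡ᵇ-reflects-≡ m n = fromEquivalence (≡ᵇ⇒≡ m n) (≡⇒≡ᵇ m n)

≤ᵇ-true : ∀ {m n} → m ≤ n → (m ≤ᵇ n) ≡ true
≤ᵇ-true = reflects-⇐ (≤ᵇ-reflects-≤ _ _)

≤ᵇ-false : ∀ {m n} → ¬ m ≤ n → (m ≤ᵇ n) ≡ false
≤ᵇ-false = reflects-¬⇐ (≤ᵇ-reflects-≤ _ _)

≡ᵇ-false : ∀ {m n} → m ≢ n → (m ≡ᵇ n) ≡ false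
≡ᵇ-false = reflects-¬⇐ (≡ᵇ-reflects-≡ _ _)

≡ᵇ-refl : ∀ n → (n ≡ᵇ n) ≡ true
≡ᵇ-refl n = reflects-⇐ (≡ᵇ-reflects-≡ n n) refl

∧-split : ∀ {x y} → x ∧ y ≡ true → x ≡ true × y ≡ true
∧-split {true} {true} _ = refl , refl

not≡true⇒≡false : ∀ {x} → not x ≡ true → x ≡ false
not≡true⇒≡false {false} _ = refl

not[1≤ᵇn]⇒n≡0 : ∀ {n} → not (1 ≤ᵇ n) ≡ true → n ≡ 0
not[1≤ᵇn]⇒n≡0 {zero} _ = refl

allL⁺ : ∀ f xs → (∀ {x} → x ∈ xs → f x ≡ true) → allL f xs ≡ true
allL⁺ f []       h = refl
allL⁺ f (x ∷ xs) h rewrite h (here refl) = allL⁺ f xs (h ∘ there)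

allL⁻ : ∀ f {xs x} → allL f xs ≡ true → x ∈ xs → f x ≡ true
allL⁻ f {y ∷ xs} e (here refl) = proj₁ (∧-split e)
allL⁻ f {y ∷ xs} e (there x∈)  = allL⁻ f (proj₂ (∧-split {f y} e)) x∈

allL-cong : ∀ {f g} xs → (∀ {x} → x ∈ xs → f x ≡ g x) → allL f xs ≡ allL g xs
allL-cong []       h = refl
allL-cong (x ∷ xs) h = cong₂ _∧_ (h (here refl)) (allL-cong xs (h ∘ there))

×-irrelevant : ∀ {A B : Set} → Nullary.Irrelevant A → Nullary.Irrelevant B →
               Nullary.Irrelevant (A × B)
×-irrelevant A-irr B-irr (a , b) (a' , b') = cong₂ _,_ (A-irr a a') (B-irr b b')

↔-by-involution : ∀ {A : Set} {P Q : A → Set} (f : A → A) → (∀ x → f (f x) ≡ x) →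
                  Irrelevant P → Irrelevant Q →
                  (∀ {x} → P x → Q (f x)) → (∀ {x} → Q x → P (f x)) → Σ A P ↔ Σ A Q
↔-by-involution f f-involutive P-irr Q-irr P⇒Q Q⇒P = mk↔ₛ′
  (λ (x , p) → f x , P⇒Q p)
  (λ (y , q) → f y , Q⇒P q)
  (λ (y , q) → Σ-≡,≡→≡ (f-involutive y , Q-irr _ _))
  (λ (x , p) → Σ-≡,≡→≡ (f-involutive x , P-irr _ _))

-- Gaps and repeated sizes in a list of parts

gapAt-intro : ∀ π r t → r ≤ t → (∀ i → i < r → mult π (t ∸ i) ≡ 0) → gapAt π r t ≡ true
gapAt-intro π r t r≤t h rewrite ≤ᵇ-true r≤t =
  allL⁺ _ (upTo r) (λ i∈ → cong (λ x → not (1 ≤ᵇ x)) (h _ (∈-upTo⁻ i∈)))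

gapAt-false : ∀ π r t i → i < r → mult π (t ∸ i) ≢ 0 → gapAt π r t ≡ false
gapAt-false π r t i i<r present =
  ¬-not λ gap →
    present (not[1≤ᵇn]⇒n≡0 (allL⁻ _ (proj₂ (∧-split {r ≤ᵇ t} gap)) (∈-upTo⁺ i<r)))

gapAt-cong : ∀ π π' r t → (∀ u → u ≤ t → mult π u ≡ mult π' u) →
             gapAt π r t ≡ gapAt π' r t
gapAt-cong π π' r t h = cong ((r ≤ᵇ t) ∧_) (allL-cong (upTo r) λ {i} _ →
  cong (λ x → not (1 ≤ᵇ x)) (h (t ∸ i) (m∸n≤m t i)))

searchDown-cong : ∀ π π' r t → (∀ u → u ≤ t → mult π u ≡ mult π' u) →
                  searchDown π r t ≡ searchDown π' r t
searchDown-cong π π' r zero    h = refl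
searchDown-cong π π' r (suc t) h = cong₂ (λ gap below → if gap then suc t else below)
  (gapAt-cong π π' r (suc t) h) (searchDown-cong π π' r t (λ u → h u ∘ m≤n⇒m≤1+n))

searchDown-gap : ∀ π r t → 1 ≤ t → gapAt π r t ≡ true → searchDown π r t ≡ t
searchDown-gap π r (suc t) _ gap rewrite gap = refl

searchDown-skip : ∀ π r {s t} → s ≤′ t → (∀ u → s < u → u ≤ t → gapAt π r u ≡ false) →
                  searchDown π r t ≡ searchDown π r s
searchDown-skip π r ≤′-refl h = refl
searchDown-skip π r (≤′-step {t} s≤′t) h rewrite h (suc t) (s≤s (≤′⇒≤ s≤′t)) ≤-refl =
  searchDown-skip π r s≤′t (λ u s<u u≤t → h u s<u (m≤n⇒m≤1+n u≤t))

smallestRepeating-intro : ∀ r π j → 1 ≤ j → r < mult π j → (∀ i → i < j → mult π i ≤ r) →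
                          isSmallestRepeating r π j ≡ true
smallestRepeating-intro r π j j≥1 rep below rewrite ≤ᵇ-true j≥1 | ≤ᵇ-true rep =
  allL⁺ _ (upTo j) λ {i} i∈ → cong not (begin
    (1 ≤ᵇ i) ∧ (suc r ≤ᵇ mult π i) ≡⟨ cong ((1 ≤ᵇ i) ∧_) (≤ᵇ-false (≤⇒≯ (below i (∈-upTo⁻ i∈)))) ⟩
    (1 ≤ᵇ i) ∧ false               ≡⟨ ∧-zeroʳ (1 ≤ᵇ i) ⟩
    false                          ∎)
  where open ≡-Reasoning

smallestRepeating-elim : ∀ r π j → isSmallestRepeating r π j ≡ true →
                         1 ≤ j × r < mult π j × (∀ i → 1 ≤ i → i < j → mult π i ≤ r)
smallestRepeating-elim r π j sr with ∧-split {1 ≤ᵇ j} sr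
... | j≥1 , sr' with ∧-split {repeating r π j} sr'
... | rep , below =
  reflects-⇒ (≤ᵇ-reflects-≤ 1 j) j≥1 , reflects-⇒ (≤ᵇ-reflects-≤ (suc r) _) rep , minimal
  where
  minimal : ∀ i → 1 ≤ i → i < j → mult π i ≤ r
  minimal i i≥1 i<j with allL⁻ (λ i → not ((1 ≤ᵇ i) ∧ repeating r π i)) below (∈-upTo⁺ i<j)
  ... | not-rep rewrite ≤ᵇ-true i≥1 =
    ≮⇒≥ (reflects-¬⇒ (≤ᵇ-reflects-≤ (suc r) _) (not≡true⇒≡false not-rep))

smallestRepeating-unique : ∀ r π {j j'} → isSmallestRepeating r π j ≡ true →
                           isSmallestRepeating r π j' ≡ true → j ≡ j'
smallestRepeating-unique r π {j} {j'} sr sr'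
  with smallestRepeating-elim r π j sr | smallestRepeating-elim r π j' sr'
... | j≥1 , rep , below | j'≥1 , rep' , below' with <-cmp j j'
... | tri< j<j' _ _ = contradiction (below' j j≥1 j<j') (<⇒≱ rep)
... | tri≈ _ j≡j' _ = j≡j'
... | tri> _ _ j'<j = contradiction (below j' j'≥1 j'<j) (<⇒≱ rep')

smallestRepeating-cong : ∀ r π π' j → (∀ u → u ≤ j → mult π u ≡ mult π' u) →
                         isSmallestRepeating r π j ≡ isSmallestRepeating r π' j
smallestRepeating-cong r π π' j h =
  cong₂ (λ x y → (1 ≤ᵇ j) ∧ x ∧ y) (cong (suc r ≤ᵇ_) (h j ≤-refl)) (allL-cong (upTo j) λ {i} i∈ →
    cong (λ x → not ((1 ≤ᵇ i) ∧ (suc r ≤ᵇ x))) (h i (<⇒≤ (∈-upTo⁻ i∈))))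

-- Overpartitions as lists of blocks

-- `block a m o ∷ bs` is the part size s = 1 + a + top bs taken m + 1 times, the last copy
-- overlined iff o; the a sizes strictly between top bs and s do not occur.
data Block : Set where
  block : (gap extra : ℕ) (bar : Bool) → Block

top : List Block → ℕ
top []                 = 0
top (block a m o ∷ bs) = suc a + top bs

count : List Block → ℕ
count []                 = 0
count (block a m o ∷ bs) = suc m + count bs

weight : List Block → ℕ
weight []                 = 0
weight (block a m o ∷ bs) = suc m * (suc a + top bs) + weight bs

run : ℕ → ℕ → Bool → List Part → List Part
run zero    s o rest = (s , o) ∷ rest
run (suc m) s o rest = (s , false) ∷ run m s o rest

parts : List Block → List Part
parts []                 = []
parts (block a m o ∷ bs) = run m (suc a + top bs) o (parts bs)

top-tail< : ∀ a bs → top bs < suc a + top bs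
top-tail< a bs = s≤s (m≤n+m (top bs) a)

mult-run : ∀ m s o rest u →
           mult (run m s o rest) u ≡ (if s ≡ᵇ u then suc m else 0) + mult rest u
mult-run zero    s o rest u = refl
mult-run (suc m) s o rest u rewrite mult-run m s o rest u with s ≡ᵇ u
... | true  = refl
... | false = refl

countGt-run : ∀ m s o rest k →
              countGt k (run m s o rest) ≡ (if k <ᵇ s then suc m else 0) + countGt k rest
countGt-run zero    s o rest k = refl
countGt-run (suc m) s o rest k rewrite countGt-run m s o rest k with k <ᵇ s
... | true  = refl
... | false = refl

countGe-run : ∀ m s o rest j →
              countGe j (run m s o rest) ≡ (if j ≤ᵇ s then suc m else 0) + countGe j rest
countGe-run zero    s o rest j = refl
countGe-run (suc m) s o rest j rewrite countGe-run m s o rest j with j ≤ᵇ s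
... | true  = refl
... | false = refl

largest-run : ∀ m s o rest → largest (run m s o rest) ≡ s ⊔ largest rest
largest-run zero    s o rest = refl
largest-run (suc m) s o rest rewrite largest-run m s o rest =
  trans (sym (⊔-assoc s s (largest rest))) (cong (_⊔ largest rest) (⊔-idem s))

total-run : ∀ m s o rest → total (run m s o rest) ≡ suc m * s + total rest
total-run zero    s o rest = cong (_+ total rest) (sym (+-identityʳ s))
total-run (suc m) s o rest rewrite total-run m s o rest = sym (+-assoc s (suc m * s) (total rest))

mult-parts-above : ∀ bs u → top bs < u → mult (parts bs) u ≡ 0
mult-parts-above []                 u _ = refl
mult-parts-above (block a m o ∷ bs) u top<u
  rewrite mult-run m (suc a + top bs) o (parts bs) u | ≡ᵇ-false (<⇒≢ top<u) =
  mult-parts-above bs u (<-trans (top-tail< a bs) top<u)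

mult-parts-below : ∀ a m o bs u → u < suc a + top bs →
                   mult (parts (block a m o ∷ bs)) u ≡ mult (parts bs) u
mult-parts-below a m o bs u u<top rewrite mult-run m (suc a + top bs) o (parts bs) u
  | ≡ᵇ-false (>⇒≢ u<top) = refl

mult-parts-top : ∀ a m o bs → mult (parts (block a m o ∷ bs)) (suc a + top bs) ≡ suc m
mult-parts-top a m o bs rewrite mult-run m (suc a + top bs) o (parts bs) (suc a + top bs)
  | ≡ᵇ-refl (a + top bs) | mult-parts-above bs _ (top-tail< a bs) = +-identityʳ (suc m)

countGt-parts-≤top : ∀ bs k → top bs ≤ k → countGt k (parts bs) ≡ 0
countGt-parts-≤top []                 k _ = refl
countGt-parts-≤top (block a m o ∷ bs) k top≤k
  rewrite countGt-run m (suc a + top bs) o (parts bs) k | ≤ᵇ-false (≤⇒≯ top≤k) =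
  countGt-parts-≤top bs k (<⇒≤ (<-≤-trans (top-tail< a bs) top≤k))

countGe-parts-above : ∀ bs j → top bs < j → countGe j (parts bs) ≡ 0
countGe-parts-above []                 j _ = refl
countGe-parts-above (block a m o ∷ bs) j top<j
  rewrite countGe-run m (suc a + top bs) o (parts bs) j | ≤ᵇ-false (<⇒≱ top<j) =
  countGe-parts-above bs j (<-trans (top-tail< a bs) top<j)

largest-parts : ∀ bs → largest (parts bs) ≡ top bs
largest-parts []                 = refl
largest-parts (block a m o ∷ bs) rewrite largest-run m (suc a + top bs) o (parts bs) | largest-parts bs =
  m≥n⇒m⊔n≡m (<⇒≤ (top-tail< a bs))

total-parts : ∀ bs → total (parts bs) ≡ weight bs
total-parts []                 = refl
total-parts (block a m o ∷ bs) rewrite total-run m (suc a + top bs) o (parts bs) | total-parts bs = refl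

adjHead : Part → List Part → Bool
adjHead p []      = true
adjHead p (q ∷ _) = adjOK p q

wellOrdered-∷ : ∀ p l → adjHead p l ≡ true → wellOrdered l ≡ true → wellOrdered (p ∷ l) ≡ true
wellOrdered-∷ p []      _   _  = refl
wellOrdered-∷ p (q ∷ l) adj wo rewrite adj | wo = refl

wellOrdered-∷⁻ : ∀ p l → wellOrdered (p ∷ l) ≡ true → adjHead p l ≡ true × wellOrdered l ≡ true
wellOrdered-∷⁻ p []      _  = refl , refl
wellOrdered-∷⁻ p (q ∷ l) wo = ∧-split wo

adjOK-same : ∀ s o → adjOK (s , false) (s , o) ≡ true
adjOK-same s o rewrite ≤ᵇ-true (≤-refl {s}) | ≡ᵇ-refl s = refl

adjOK-< : ∀ {s s'} o o' → s' < s → adjOK (s , o) (s' , o') ≡ true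
adjOK-< o o' s'<s rewrite ≤ᵇ-true (<⇒≤ s'<s) | ≡ᵇ-false (>⇒≢ s'<s) = refl

adjOK-≤ : ∀ {s s' o o'} → adjOK (s , o) (s' , o') ≡ true → s' ≤ s
adjOK-≤ {s} {s'} adj = reflects-⇒ (≤ᵇ-reflects-≤ s' s) (proj₁ (∧-split adj))

adjOK-bar : ∀ {s o o'} → adjOK (s , o) (s , o') ≡ true → o ≡ false
adjOK-bar {s} adj rewrite ≤ᵇ-true (≤-refl {s}) | ≡ᵇ-refl s = not≡true⇒≡false adj

adjHead-run : ∀ p m s o rest → ∃ λ x → adjHead p (run m s o rest) ≡ adjOK p (s , x)
adjHead-run p zero    s o rest = o , refl
adjHead-run p (suc m) s o rest = false , refl

wellOrdered-run : ∀ m s o rest → adjHead (s , o) rest ≡ true → wellOrdered rest ≡ true →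
                  wellOrdered (run m s o rest) ≡ true
wellOrdered-run zero    s o rest adj wo = wellOrdered-∷ (s , o) rest adj wo
wellOrdered-run (suc m) s o rest adj wo with adjHead-run (s , false) m s o rest
... | x , e =
  wellOrdered-∷ (s , false) (run m s o rest) (trans e (adjOK-same s x)) (wellOrdered-run m s o rest adj wo)

top<⇒adjHead-parts : ∀ s o bs → top bs < s → adjHead (s , o) (parts bs) ≡ true
top<⇒adjHead-parts s o []                  _       = refl
top<⇒adjHead-parts s o (block a m o' ∷ bs) top<s
  with adjHead-run (s , o) m (suc a + top bs) o' (parts bs)
... | x , e = trans e (adjOK-< o x top<s)

adjHead-parts⇒top≤ : ∀ s o bs → adjHead (s , o) (parts bs) ≡ true → top bs ≤ s
adjHead-parts⇒top≤ s o []                  _   = z≤n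
adjHead-parts⇒top≤ s o (block a m o' ∷ bs) adj
  with adjHead-run (s , o) m (suc a + top bs) o' (parts bs)
... | x , e = adjOK-≤ {o = o} {o' = x} (trans (sym e) adj)

wellOrdered-parts : ∀ bs → wellOrdered (parts bs) ≡ true
wellOrdered-parts []                 = refl
wellOrdered-parts (block a m o ∷ bs) =
  wellOrdered-run m _ o (parts bs) (top<⇒adjHead-parts _ o bs (top-tail< a bs)) (wellOrdered-parts bs)

allPositive-run : ∀ m s o rest → allPositive rest ≡ true → allPositive (run m (suc s) o rest) ≡ true
allPositive-run zero    s o rest pos = pos
allPositive-run (suc m) s o rest pos = allPositive-run m s o rest pos

allPositive-parts : ∀ bs → allPositive (parts bs) ≡ true
allPositive-parts []                 = refl
allPositive-parts (block a m o ∷ bs) =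
  allPositive-run m (a + top bs) o (parts bs) (allPositive-parts bs)

parts-valid : ∀ {n} bs → weight bs ≡ n → T (isOverpartitionOf n (parts bs))
parts-valid bs refl
  rewrite wellOrdered-parts bs | allPositive-parts bs | total-parts bs = ≡⇒≡ᵇ (weight bs) _ refl

bump : List Block → List Block
bump []                 = []
bump (block a m o ∷ bs) = block a (suc m) o ∷ bs

push : Part → List Block → List Block
push (s , o) bs = if s ≡ᵇ top bs then bump bs else block (s ∸ suc (top bs)) 0 o ∷ bs

blocks : List Part → List Block
blocks []      = []
blocks (p ∷ π) = push p (blocks π)

blocks-run : ∀ a m o bs rest → blocks rest ≡ bs →
             blocks (run m (suc a + top bs) o rest) ≡ block a m o ∷ bs
blocks-run a zero    o bs rest refl
  rewrite ≡ᵇ-false (>⇒≢ (top-tail< a bs)) | m+n∸n≡m a (top bs) = refl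
blocks-run a (suc m) o bs rest e rewrite blocks-run a m o bs rest e | ≡ᵇ-refl (a + top bs) = refl

blocks-parts : ∀ bs → blocks (parts bs) ≡ bs
blocks-parts []                 = refl
blocks-parts (block a m o ∷ bs) = blocks-run a m o bs (parts bs) (blocks-parts bs)

parts-bump : ∀ o bs → 1 ≤ top bs → adjHead (top bs , o) (parts bs) ≡ true →
             parts (bump bs) ≡ (top bs , o) ∷ parts bs
parts-bump o (block a m o' ∷ bs) _ adj
  with adjHead-run (suc a + top bs , o) m (suc a + top bs) o' (parts bs)
... | x , e with refl ← adjOK-bar {suc a + top bs} {o} {x} (trans (sym e) adj) = refl

parts-push : ∀ s o bs → 1 ≤ s → adjHead (s , o) (parts bs) ≡ true →
             parts (push (s , o) bs) ≡ (s , o) ∷ parts bs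
parts-push s o bs 1≤s adj with s ≡ᵇ top bs in eq
... | true with refl ← reflects-⇒ (≡ᵇ-reflects-≡ s (top bs)) eq = parts-bump o bs 1≤s adj
... | false = cong (λ z → (z , o) ∷ parts bs) (trans (sym (+-suc _ (top bs))) (m∸n+n≡m top<s))
  where
  top<s : top bs < s
  top<s = ≤∧≢⇒< (adjHead-parts⇒top≤ s o bs adj)
                 (λ top≡s → reflects-¬⇒ (≡ᵇ-reflects-≡ s (top bs)) eq (sym top≡s))

parts-blocks : ∀ π → wellOrdered π ≡ true → allPositive π ≡ true → parts (blocks π) ≡ π
parts-blocks []            _  _   = refl
parts-blocks ((s , o) ∷ π) wo pos with wellOrdered-∷⁻ (s , o) π wo | ∧-split pos
... | adj , wo' | 1≤s , pos' with ih ← parts-blocks π wo' pos' =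
  trans (parts-push s o (blocks π) (reflects-⇒ (≤ᵇ-reflects-≤ 1 s) 1≤s)
                    (subst (λ l → adjHead (s , o) l ≡ true) (sym ih) adj))
        (cong ((s , o) ∷_) ih)

-- Transposing the Ferrers diagram

transpose : List Block → List Block
transpose []                 = []
transpose (block a m o ∷ bs) = transpose bs ++ [ block m a o ]

transpose-++ : ∀ xs ys → transpose (xs ++ ys) ≡ transpose ys ++ transpose xs
transpose-++ []                 ys = sym (++-identityʳ (transpose ys))
transpose-++ (block a m o ∷ xs) ys rewrite transpose-++ xs ys =
  ++-assoc (transpose ys) (transpose xs) [ block m a o ]

transpose-involutive : ∀ bs → transpose (transpose bs) ≡ bs
transpose-involutive []                 = refl
transpose-involutive (block a m o ∷ bs)
  rewrite transpose-++ (transpose bs) [ block m a o ] | transpose-involutive bs = refl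

top-++ : ∀ xs ys → top (xs ++ ys) ≡ top xs + top ys
top-++ []                 ys = refl
top-++ (block a m o ∷ xs) ys rewrite top-++ xs ys = sym (+-assoc (suc a) (top xs) (top ys))

count-++ : ∀ xs ys → count (xs ++ ys) ≡ count xs + count ys
count-++ []                 ys = refl
count-++ (block a m o ∷ xs) ys rewrite count-++ xs ys = sym (+-assoc (suc m) (count xs) (count ys))

count-transpose : ∀ bs → count (transpose bs) ≡ top bs
count-transpose []                 = refl
count-transpose (block a m o ∷ bs)
  rewrite count-++ (transpose bs) [ block m a o ] | count-transpose bs =
  trans (cong (top bs +_) (+-identityʳ (suc a))) (+-comm (top bs) (suc a))

weight-++ : ∀ xs ys → weight (xs ++ ys) ≡ weight xs + weight ys + count xs * top ys
weight-++ []                 ys = sym (+-identityʳ (weight ys))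
weight-++ (block a m o ∷ xs) ys rewrite weight-++ xs ys | top-++ xs ys =
  lemma (suc m) (suc a) (top xs) (top ys) (weight xs) (weight ys) (count xs)
  where
  lemma : ∀ m a s t x y c →
          m * (a + (s + t)) + (x + y + c * t) ≡ m * (a + s) + x + y + (m + c) * t
  lemma = solve-∀

weight-transpose : ∀ bs → weight (transpose bs) ≡ weight bs
weight-transpose []                 = refl
weight-transpose (block a m o ∷ bs)
  rewrite weight-++ (transpose bs) [ block m a o ] | weight-transpose bs | count-transpose bs =
  lemma (suc m) (suc a) (top bs) (weight bs)
  where
  lemma : ∀ m a s x → x + (a * (m + 0) + 0) + s * (m + 0) ≡ m * (a + s) + x
  lemma = solve-∀

-- maes and the parts above it

-- maes(π; r) + 1 is the size of the first block, from the top, with at least r missing sizes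
-- below it; maesStat returns the number of parts down to that block, and maes.
maesStat : ℕ → List Block → Maybe (ℕ × ℕ)
maesStat r []                 = nothing
maesStat r (block a m o ∷ bs) with r ≤? a
... | yes _ = just (suc m , a + top bs)
... | no  _ = Maybe.map (map₁ (suc m +_)) (maesStat r bs)

gapAt-parts-above : ∀ r bs t → r + top bs ≤ t → gapAt (parts bs) r t ≡ true
gapAt-parts-above r bs t r+top≤t =
  gapAt-intro (parts bs) r t (m+n≤o⇒m≤o r r+top≤t) (λ i → mult-parts-above bs (t ∸ i) ∘ top<t∸i i)
  where
  open ≤-Reasoning
  top<t∸i : ∀ i → i < r → top bs < t ∸ i
  top<t∸i i i<r = m+n≤o⇒m≤o∸n (suc (top bs)) (begin
    suc (top bs) + i ≡⟨ +-comm (suc (top bs)) i ⟩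
    i + suc (top bs) ≡⟨ +-suc i (top bs) ⟩
    suc i + top bs   ≤⟨ +-monoˡ-≤ (top bs) i<r ⟩
    r + top bs       ≤⟨ r+top≤t ⟩
    t                ∎)

gapAt-parts-top : ∀ r bs t → top bs ≤ t → t < r + top bs → gapAt (parts bs) r t ≡ false
gapAt-parts-top r [] t _ t<r+0 =
  cong (_∧ allL _ (upTo r)) (≤ᵇ-false (<⇒≱ (subst (t <_) (+-identityʳ r) t<r+0)))
gapAt-parts-top r (block a m o ∷ bs) t s≤t t<r+s =
  gapAt-false π r t (t ∸ s) (subst (t ∸ s <_) (m+n∸n≡m r s) (∸-monoˡ-< t<r+s s≤t)) λ mult≡0 →
    1+n≢0 (begin
      suc m               ≡⟨ mult-parts-top a m o bs ⟨
      mult π s            ≡⟨ cong (mult π) (m∸[m∸n]≡n s≤t) ⟨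
      mult π (t ∸ (t ∸ s)) ≡⟨ mult≡0 ⟩
      0                   ∎)
  where
  open ≡-Reasoning
  π = parts (block a m o ∷ bs)
  s = suc a + top bs

searchDown-parts : ∀ {r} → 1 ≤ r → ∀ bs →
                   searchDown (parts bs) r (top bs ∸ 1) ≡ maybe′ proj₂ 0 (maesStat r bs)
searchDown-parts r≥1 [] = refl
searchDown-parts {r} r≥1 (block a m o ∷ bs) =
  trans (searchDown-cong _ _ r _ λ u u≤t → mult-parts-below a m o bs u (s≤s u≤t)) below-block
  where
  open ≡-Reasoning
  below-block : searchDown (parts bs) r (a + top bs) ≡
                maybe′ proj₂ 0 (maesStat r (block a m o ∷ bs))
  below-block with r ≤? a
  ... | yes r≤a = searchDown-gap (parts bs) r _ (≤-trans r≥1 (≤-trans r≤a (m≤m+n a (top bs))))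
                    (gapAt-parts-above r bs _ (+-monoˡ-≤ (top bs) r≤a))
  ... | no r≰a = begin
    searchDown (parts bs) r (a + top bs)
      ≡⟨ searchDown-skip (parts bs) r (≤⇒≤′ tail≤t) no-gap ⟩
    searchDown (parts bs) r (top bs ∸ 1)
      ≡⟨ searchDown-parts r≥1 bs ⟩
    maybe′ proj₂ 0 (maesStat r bs)
      ≡⟨ maybe′-map proj₂ 0 (map₁ (suc m +_)) (maesStat r bs) ⟨
    maybe′ proj₂ 0 (Maybe.map (map₁ (suc m +_)) (maesStat r bs))
      ∎
    where
    tail≤t = ≤-trans (m∸n≤m (top bs) 1) (m≤n+m (top bs) a)
    m∸1<n⇒m≤n : ∀ {m n} → m ∸ 1 < n → m ≤ n
    m∸1<n⇒m≤n {zero}  _   = z≤n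
    m∸1<n⇒m≤n {suc m} m<n = m<n
    no-gap : ∀ u → top bs ∸ 1 < u → u ≤ a + top bs → gapAt (parts bs) r u ≡ false
    no-gap u lo hi =
      gapAt-parts-top r bs u (m∸1<n⇒m≤n lo) (≤-<-trans hi (+-monoˡ-< (top bs) (≰⇒> r≰a)))

maes-parts : ∀ {r} → 1 ≤ r → ∀ bs → maes (parts bs) r ≡ maybe′ proj₂ 0 (maesStat r bs)
maes-parts r≥1 bs rewrite largest-parts bs = searchDown-parts r≥1 bs

maesStat-countGt : ∀ r bs {j k} → maesStat r bs ≡ just (j , k) →
                   countGt k (parts bs) ≡ j × k < top bs
maesStat-countGt r (block a m o ∷ bs) e with r ≤? a
maesStat-countGt r (block a m o ∷ bs) refl | yes _
  rewrite countGt-run m (suc a + top bs) o (parts bs) (a + top bs)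
        | ≤ᵇ-true (≤-refl {suc (a + top bs)})
        | countGt-parts-≤top bs (a + top bs) (m≤n+m (top bs) a) = +-identityʳ (suc m) , ≤-refl
... | no _ with maesStat r bs in eq
maesStat-countGt r (block a m o ∷ bs) refl | no _ | just (j , k) with maesStat-countGt r bs eq
... | countGt≡j , k<top
  rewrite countGt-run m (suc a + top bs) o (parts bs) k
        | ≤ᵇ-true (<-trans k<top (top-tail< a bs)) | countGt≡j = refl , <-trans k<top (top-tail< a bs)

maesStat-sound : ∀ {r} → 1 ≤ r → ∀ bs {j k} → maesStat r bs ≡ just (j , k) →
                 maes (parts bs) r ≡ k × countGt k (parts bs) ≡ j
maesStat-sound r≥1 bs e =
  trans (maes-parts r≥1 bs) (cong (maybe′ proj₂ 0) e) , proj₁ (maesStat-countGt _ bs e)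

maesStat-complete : ∀ {r} → 1 ≤ r → ∀ bs {j k} → 1 ≤ k →
                    maes (parts bs) r ≡ k → countGt k (parts bs) ≡ j → maesStat r bs ≡ just (j , k)
maesStat-complete {r} r≥1 bs k≥1 maes≡k countGt≡j with maesStat r bs in eq | maes-parts r≥1 bs
... | nothing | maes≡0 = contradiction (trans (sym maes≡k) maes≡0) (≢-sym (<⇒≢ k≥1))
... | just (j' , k') | refl with refl ← maes≡k =
  cong (λ j → just (j , k')) (trans (sym (proj₁ (maesStat-countGt r bs eq))) countGt≡j)

-- The smallest repeating size and the parts from it upwards

-- The smallest (r+1)-repeating size is that of the last block, from the top, with more than r
-- copies; repStat returns this size and the number of parts down to that block.
repStat : ℕ → List Block → Maybe (ℕ × ℕ)
repStat r []                 = nothing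
repStat r (block a m o ∷ bs) with repStat r bs | r ≤? m
... | just (j , c) | _     = just (j , suc m + c)
... | nothing      | yes _ = just (suc a + top bs , suc m)
... | nothing      | no  _ = nothing

repStat-nothing : ∀ r bs → repStat r bs ≡ nothing → ∀ u → mult (parts bs) u ≤ r
repStat-nothing r []                 _ u = z≤n
repStat-nothing r (block a m o ∷ bs) e u with repStat r bs in eq | r ≤? m
repStat-nothing r (block a m o ∷ bs) () u | just _  | _
repStat-nothing r (block a m o ∷ bs) () u | nothing | yes _
... | nothing | no r≰m with <-cmp u (suc a + top bs)
... | tri< u<s _ _ rewrite mult-parts-below a m o bs u u<s = repStat-nothing r bs eq u
... | tri≈ _ refl _ rewrite mult-parts-top a m o bs = ≰⇒> r≰m
... | tri> _ _ s<u rewrite mult-parts-above (block a m o ∷ bs) u s<u = z≤n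

repStat-just : ∀ r bs {j c} → repStat r bs ≡ just (j , c) →
               isSmallestRepeating r (parts bs) j ≡ true × countGe j (parts bs) ≡ c × j ≤ top bs
repStat-just r (block a m o ∷ bs) e with repStat r bs in eq | r ≤? m
repStat-just r (block a m o ∷ bs) refl | just (j , c) | _ with repStat-just r bs eq
... | sr , countGe≡c , j≤top = sr' , countGe≡ , j≤s
  where
  j≤s = ≤-trans j≤top (<⇒≤ (top-tail< a bs))
  sr' = trans (smallestRepeating-cong r (parts (block a m o ∷ bs)) (parts bs) j λ u u≤j →
                 mult-parts-below a m o bs u (≤-<-trans u≤j (≤-<-trans j≤top (top-tail< a bs)))) sr
  countGe≡ = trans (countGe-run m (suc a + top bs) o (parts bs) j)
                   (cong₂ _+_ (cong (if_then suc m else 0) (≤ᵇ-true j≤s)) countGe≡c)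
repStat-just r (block a m o ∷ bs) refl | nothing | yes r≤m = sr , countGe≡ , ≤-refl
  where
  s = suc a + top bs
  sr = smallestRepeating-intro r (parts (block a m o ∷ bs)) s (s≤s z≤n)
         (subst (r <_) (sym (mult-parts-top a m o bs)) (s≤s r≤m))
         (λ i i<s → subst (_≤ r) (sym (mult-parts-below a m o bs i i<s)) (repStat-nothing r bs eq i))
  countGe≡ : countGe s (parts (block a m o ∷ bs)) ≡ suc m
  countGe≡ rewrite countGe-run m s o (parts bs) s | ≤ᵇ-true (≤-refl {s})
                 | countGe-parts-above bs s (top-tail< a bs) = +-identityʳ (suc m)

repStat-complete : ∀ r bs {j c} → isSmallestRepeating r (parts bs) j ≡ true →
                   countGe j (parts bs) ≡ c → repStat r bs ≡ just (j , c)
repStat-complete r bs {j} sr countGe≡c with repStat r bs in eq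
... | nothing =
  contradiction (repStat-nothing r bs eq j) (<⇒≱ (proj₁ (proj₂ (smallestRepeating-elim r (parts bs) j sr))))
... | just (j' , c') with repStat-just r bs eq
... | sr' , countGe≡c' , _ with refl ← smallestRepeating-unique r (parts bs) {j} {j'} sr sr' =
  cong (λ c → just (j , c)) (trans (sym countGe≡c') countGe≡c)

repStat-snoc-repeated : ∀ r g c o → r ≤ c → ∀ ys →
                        repStat r (ys ++ [ block g c o ]) ≡ just (suc g + 0 , suc c + count ys)
repStat-snoc-repeated r g c o r≤c [] with r ≤? c
... | yes _   = cong (λ n → just (suc g + 0 , n)) (sym (+-identityʳ (suc c)))
... | no r≰c  = contradiction r≤c r≰c
repStat-snoc-repeated r g c o r≤c (block a m o' ∷ ys) rewrite repStat-snoc-repeated r g c o r≤c ys =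
  cong (λ n → just (suc g + 0 , n)) (+-comm-middle (suc m) (suc c) (count ys))
  where
  +-comm-middle : ∀ x y z → x + (y + z) ≡ y + (x + z)
  +-comm-middle = solve-∀

repStat-snoc-unrepeated : ∀ r g c o → ¬ r ≤ c → ∀ ys →
                          repStat r (ys ++ [ block g c o ]) ≡
                          Maybe.map (map₁ (_+ (suc g + 0))) (repStat r ys)
repStat-snoc-unrepeated r g c o r≰c [] with r ≤? c
... | yes r≤c = contradiction r≤c r≰c
... | no _    = refl
repStat-snoc-unrepeated r g c o r≰c (block a m o' ∷ ys)
  rewrite repStat-snoc-unrepeated r g c o r≰c ys with repStat r ys | r ≤? m
... | just _  | _     = refl
... | nothing | yes _ rewrite top-++ ys [ block g c o ] =
  cong (λ s → just (s , suc m)) (sym (+-assoc (suc a) (top ys) (suc g + 0)))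
... | nothing | no _  = refl

repStat-transpose : ∀ r bs → repStat r (transpose bs) ≡ Maybe.map (map₂ suc) (maesStat r bs)
repStat-transpose r []                 = refl
repStat-transpose r (block a m o ∷ bs) with r ≤? a
... | yes r≤a
  rewrite repStat-snoc-repeated r m a o r≤a (transpose bs) | count-transpose bs | +-identityʳ m = refl
... | no r≰a
  rewrite repStat-snoc-unrepeated r m a o r≰a (transpose bs) | repStat-transpose r bs
  with maesStat r bs
...   | nothing      = refl
...   | just (j , k) rewrite +-identityʳ m = cong (λ j → just (j , suc k)) (+-comm j (suc m))

-- Conjugation of overpartitions

InA : ℕ → ℕ → ℕ → List Part → Set
InA r j k π = maes π r ≡ k × countGt k π ≡ j

InB : ℕ → ℕ → ℕ → List Part → Set
InB r j k π = T (isSmallestRepeating r π j) × countGe j π ≡ suc k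

transpose-InA⇒InB : ∀ {r j k} → 1 ≤ r → 1 ≤ k → ∀ bs →
                    InA r j k (parts bs) → InB r j k (parts (transpose bs))
transpose-InA⇒InB {r} r≥1 k≥1 bs (maes≡k , countGt≡j)
  with repStat-just r (transpose bs) (trans (repStat-transpose r bs)
         (cong (Maybe.map (map₂ suc)) (maesStat-complete r≥1 bs k≥1 maes≡k countGt≡j)))
... | sr , countGe≡ , _ = from T-≡ sr , countGe≡

transpose-InB⇒InA : ∀ {r j k} → 1 ≤ r → ∀ bs →
                    InB r j k (parts bs) → InA r j k (parts (transpose bs))
transpose-InB⇒InA {r} r≥1 bs (sr , countGe≡) =
  maesStat-sound r≥1 (transpose bs) (unshift (maesStat r (transpose bs)) repStat≡)
  where
  open ≡-Reasoning
  repStat≡ = begin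
    Maybe.map (map₂ suc) (maesStat r (transpose bs)) ≡⟨ repStat-transpose r (transpose bs) ⟨
    repStat r (transpose (transpose bs))             ≡⟨ cong (repStat r) (transpose-involutive bs) ⟩
    repStat r bs                                     ≡⟨ repStat-complete r bs (to T-≡ sr) countGe≡ ⟩
    just _                                           ∎
  unshift : ∀ {j k} x → Maybe.map (map₂ suc) x ≡ just (j , suc k) → x ≡ just (j , k)
  unshift (just _) refl = refl

blocks-valid : ∀ {n} π → T (isOverpartitionOf n π) →
               parts (blocks π) ≡ π × weight (blocks π) ≡ n
blocks-valid {n} π valid with to (T-∧ {wellOrdered π}) valid
... | wo , valid' with to (T-∧ {allPositive π}) valid'
... | pos , total≡n = parts≡π , weight≡n
  where
  open ≡-Reasoning
  parts≡π = parts-blocks π (to T-≡ wo) (to T-≡ pos)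
  weight≡n = begin
    weight (blocks π)        ≡⟨ total-parts (blocks π) ⟨
    total (parts (blocks π)) ≡⟨ cong total parts≡π ⟩
    total π                  ≡⟨ ≡ᵇ⇒≡ (total π) n total≡n ⟩
    n                        ∎

conjugate : ∀ {n} → Overpartition n → Overpartition n
conjugate (π , valid) = parts (transpose bs) ,
  parts-valid (transpose bs) (trans (weight-transpose bs) (proj₂ (blocks-valid π valid)))
  where bs = blocks π

conjugate-involutive : ∀ {n} (π : Overpartition n) → conjugate (conjugate π) ≡ π
conjugate-involutive (π , valid) = Σ-≡,≡→≡ (parts≡π , T-irrelevant _ _)
  where
  open ≡-Reasoning
  bs = blocks π
  parts≡π = begin
    parts (transpose (blocks (parts (transpose bs)))) ≡⟨ cong (parts ∘ transpose) (blocks-parts (transpose bs)) ⟩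
    parts (transpose (transpose bs))                  ≡⟨ cong parts (transpose-involutive bs) ⟩
    parts bs                                          ≡⟨ proj₁ (blocks-valid π valid) ⟩
    π                                                 ∎

conjugate-InA⇒InB : ∀ {r j k n} → 1 ≤ r → 1 ≤ k → (π : Overpartition n) →
                     InA r j k (proj₁ π) → InB r j k (proj₁ (conjugate π))
conjugate-InA⇒InB {r} {j} {k} r≥1 k≥1 (π , valid) =
  transpose-InA⇒InB r≥1 k≥1 (blocks π) ∘ subst (InA r j k) (sym (proj₁ (blocks-valid π valid)))

conjugate-InB⇒InA : ∀ {r j k n} → 1 ≤ r → (π : Overpartition n) →
                     InB r j k (proj₁ π) → InA r j k (proj₁ (conjugate π))
conjugate-InB⇒InA {r} {j} {k} r≥1 (π , valid) =
  transpose-InB⇒InA r≥1 (blocks π) ∘ subst (InB r j k) (sym (proj₁ (blocks-valid π valid)))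

theorem2p2 : (r j k n : ℕ) → 1 ≤ r → 1 ≤ j → 1 ≤ k → SetA r j k n ↔ SetB r j k n
theorem2p2 r j k n r≥1 _ k≥1 =
  ↔-by-involution conjugate conjugate-involutive
    (×-irrelevant ≡-irrelevant ≡-irrelevant) (×-irrelevant T-irrelevant ≡-irrelevant)
    (λ {π} → conjugate-InA⇒InB r≥1 k≥1 π) (λ {π} → conjugate-InB⇒InA r≥1 π)
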